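{- Let $T=(F_0,F_1)$ be a template of order $10$ and type $(4,4,4,4)$, and let $N$ be a $4$-net of order $10$ that is a refinement of $T$. Let $Q_1$ be the set of cells in rows $0$–$3$ and columns $0$–$3$, $Q_2$ the cells in rows $0$–$3$ and columns $4$–$9$, $Q_3$ the cells in rows $4$–$9$ and columns $0$–$3$, and $Q_4$ the cells in rows $4$–$9$ and columns $4$–$9$. Write ${*}{*}xy$ for any point type whose last two bits are $x,y$. Then: (i) the four points of weight $4$ in $T$ lie in pairwise distinct rows and pairwise distinct columns; (ii) each row of $Q_2$ and each column of $Q_3$ contains exactly three points of type ${*}{*}10$ and exactly three points of type ${*}{*}01$; (iii) each line of $N$ in $\Pi_2\cup\Pi_3$ that is relational (i.e. corresponds to symbol value $1$ under the refinement) is incident with exactly one point of $Q_1$ and exactly three points of each of $Q_2$, $Q_3$ and $Q_4$; (iv) each column of $Q_2$ and each row of $Q_3$ contains exactly two points of type ${*}{*}01$ and exactly two points of type ${*}{*}10$; moreover each row and each column of $Q_4$ contains exactly two points of type $0011$ and exactly four points of type $0000$.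
   Context: A $k$-net of order $n$ is a set $P$ of $n^2$ points and a set of $kn$ lines (subsets of $P$) of size $n$, each point on $k$ lines, the lines partitioned into $k$ parallel classes $\Pi_0,\dots,\Pi_{k-1}$ of $n$ pairwise disjoint lines, any two lines from different classes meeting in exactly one point. Equivalently, identifying points with cells $(i,j)$ of an $n\times n$ array with $\Pi_0$ the rows and $\Pi_1$ the columns, each class $\Pi_i$ ($i\ge2$) is given by a Latin square $L_{i-2}$ whose symbols index the lines of $\Pi_i$ (a line is the set of cells containing a given symbol); the squares $L_0,\dots,L_{k-3}$ are mutually orthogonal. A binary frequency square of order $n$ with frequencies $(n-\lambda,\lambda)$ is an $n\times n$ array over $\{0,1\}$ in which every row and every column contains exactly $\lambda$ ones. Two such squares with frequencies $(n-\lambda,\lambda)$ and $(n-\mu,\mu)$ are orthogonal if the number of cells with entry pair $(a,b)$ equals $\lambda_a\mu_b$, where $\lambda_1=\lambda,\lambda_0=n-\lambda,\mu_1=\mu,\mu_0=n-\mu$. For even $n$, a template of order $n$ and type $(\lambda_0,\dots,\lambda_{k-1})$ (all $\lambda_i$ even) is a list $(F_0,\dots,F_{k-3})$ of mutually orthogonal binary frequency squares of order $n$, with $F_{t-2}$ having frequencies $(n-\lambda_t,\lambda_t)$ for $2\le t\le k-1$; rows $0,\dots,\lambda_0-1$ and columns $0,\dots,\lambda_1-1$ are called relational. The type of a cell (point) $(i,j)$ is the binary string $x\,y\,F_0[i,j]\cdots F_{k-3}[i,j]$ where $x=1$ iff row $i$ is relational and $y=1$ iff column $j$ is relational; its weight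 is the number of ones in its type. It is required that every point has weight congruent mod $2$ to $\chi=\frac12\sum_i\lambda_i$. A $k$-net $N$ of order $n$ (with ordered parallel classes, $\Pi_0$ = rows, $\Pi_1$ = columns, $\Pi_i$ given by Latin square $L_{i-2}$ for $i\ge2$) is a refinement of the template if there are maps $\theta_i$ from the symbol set of $L_i$ to $\{0,1\}$ with $\theta_i(L_i[r,c])=F_i[r,c]$ for all cells; a line of $\Pi_i$ ($i\geq 2$) is then called relational if its symbol is mapped to $1$. -}

module Defs where

open import Data.Nat using (ℕ; zero; suc; _+_; _*_; _<ᵇ_; _≤ᵇ_; _%_)
open import Data.Nat.Properties using ()
open import Data.Nat.Base using (⌊_/2⌋)
open import Data.Bool using (Bool; true; false; if_then_else_; _∧_; not)
open import Data.Fin using (Fin; toℕ) renaming (zero to fzero; suc to fsuc)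
import Data.Fin as F
open import Data.Product using (_×_; _,_)
open import Relation.Binary.PropositionalEquality using (_≡_)
open import Relation.Nullary using (does)
open import Function.Definitions using (Bijective)

-- n × n arrays indexed by (row, column)
Square : ℕ → Set → Set
Square n A = Fin n → Fin n → A

sumF : ∀ {n} → (Fin n → ℕ) → ℕ
sumF {zero}  f = 0
sumF {suc n} f = f fzero + sumF (λ i → f (fsuc i))

bit : Bool → ℕ
bit true  = 1
bit false = 0

countF : ∀ {n} → (Fin n → Bool) → ℕ
countF p = sumF (λ i → bit (p i))

countCells : ∀ {n} → Square n Bool → ℕ
countCells p = sumF (λ r → countF (p r))

IsLatin : ∀ {n} → Square n (Fin n) → Set
IsLatin {n} L = (∀ r → Bijective _≡_ _≡_ (L r)) × (∀ c → Bijective _≡_ _≡_ (λ r → L r c))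

Orthogonal : ∀ {n} → Square n (Fin n) → Square n (Fin n) → Set
Orthogonal {n} L M = Bijective {A = Fin n × Fin n} _≡_ _≡_ (λ { (r , c) → (L r c , M r c) })

-- a 4-net of order n: rows, columns and the classes given by L0, L1
Is4Net : ∀ {n} → Square n (Fin n) → Square n (Fin n) → Set
Is4Net L0 L1 = IsLatin L0 × IsLatin L1 × Orthogonal L0 L1

IsFreqSquare : ∀ {n} → ℕ → Square n Bool → Set
IsFreqSquare {n} λ' F = (∀ r → countF (F r) ≡ λ') × (∀ c → countF (λ r → F r c) ≡ λ')

freq : ℕ → ℕ → Bool → ℕ
freq n λ' true  = λ'
freq n λ' false = n Data.Nat.∸ λ'

eqB : Bool → Bool → Bool
eqB true  true  = true
eqB false false = true
eqB _     _     = false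

FreqOrthogonal : ∀ {n} → ℕ → ℕ → Square n Bool → Square n Bool → Set
FreqOrthogonal {n} λ' μ F G =
  ∀ a b → countCells (λ r c → eqB (F r c) a ∧ eqB (G r c) b) ≡ freq n λ' a * freq n μ b

Even : ℕ → Set
Even m = m % 2 ≡ 0

relRow : ∀ {n} → ℕ → Fin n → Bool
relRow λ0 i = toℕ i <ᵇ λ0

-- weight of cell (i , j) for a template (F0 , F1) with λ0, λ1 the first two type entries
weight : ∀ {n} → ℕ → ℕ → Square n Bool → Square n Bool → Fin n → Fin n → ℕ
weight λ0 λ1 F0 F1 i j = bit (relRow λ0 i) + bit (relRow λ1 j) + bit (F0 i j) + bit (F1 i j)

IsTemplate4 : (n λ0 λ1 λ2 λ3 : ℕ) → Square n Bool → Square n Bool → Set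
IsTemplate4 n λ0 λ1 λ2 λ3 F0 F1 =
  Even n × Even λ0 × Even λ1 × Even λ2 × Even λ3 ×
  IsFreqSquare λ2 F0 × IsFreqSquare λ3 F1 × FreqOrthogonal λ2 λ3 F0 F1 ×
  (∀ i j → weight λ0 λ1 F0 F1 i j % 2 ≡ ⌊ λ0 + λ1 + λ2 + λ3 /2⌋ % 2)

Refines : ∀ {n} → Square n (Fin n) → Square n (Fin n) → Square n Bool → Square n Bool →
          (Fin n → Bool) → (Fin n → Bool) → Set
Refines L0 L1 F0 F1 θ0 θ1 = (∀ r c → θ0 (L0 r c) ≡ F0 r c) × (∀ r c → θ1 (L1 r c) ≡ F1 r c)

low : Fin 10 → Bool
low i = toℕ i <ᵇ 4

high : Fin 10 → Bool
high i = 4 ≤ᵇ toℕ i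

symEq : ∀ {n} → Fin n → Fin n → Bool
symEq s t = does (s F.≟ t)

lastBits : Bool → Bool → Bool → Bool → Bool
lastBits f0 f1 x y = eqB f0 x ∧ eqB f1 y

weightIs4 : Square 10 Bool → Square 10 Bool → Fin 10 → Fin 10 → Bool
weightIs4 F0 F1 r c = does (weight 4 4 F0 F1 r c Data.Nat.≟ 4)

QuadCounts : Square 10 Bool → Set
QuadCounts ℓ =
  (countCells (λ r c → low r ∧ low c ∧ ℓ r c) ≡ 1) ×
  (countCells (λ r c → low r ∧ high c ∧ ℓ r c) ≡ 3) ×
  (countCells (λ r c → high r ∧ low c ∧ ℓ r c) ≡ 3) ×
  (countCells (λ r c → high r ∧ high c ∧ ℓ r c) ≡ 3)

-- Since χ = 8, every point has even weight, i.e. F0 ⊕ F1 = [r relational] ⊕ [c relational].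
-- Along a relational row the four relational columns thus carry types 11/00 and the other six
-- carry 10/01; as F0 and F1 each have four ones on the row, it has one point of type 11 among
-- the relational columns and three each of 10 and 01 elsewhere. The non-relational lines are
-- counted the same way, and (i) follows because points of weight 4 are the type-11 points of
-- relational rows in relational columns. A relational line ℓ of Π2 meets every row and column
-- once and carries F0 = 1, so it has F1 = 1 exactly on Q1 ∪ Q4; by orthogonality it meets each
-- of the four relational lines of Π3 once, so |ℓ ∩ (Q1 ∪ Q4)| = 4. With |ℓ ∩ (Q1 ∪ Q2)| =
-- |ℓ ∩ (Q1 ∪ Q3)| = 4 and |ℓ ∩ (Q2 ∪ Q4)| = 6 this forces the counts 1, 3, 3, 3.
module Submission where

open import Defs
open import Data.Nat using (ℕ; zero; suc; _+_; _*_; _%_)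
import Data.Nat as ℕ
open import Data.Nat.Properties
  using (+-*-semiring; +-identityʳ; *-identityˡ; m+n≡0⇒m≡0; m+n≡0⇒n≡0; suc-injective)
open import Algebra.Properties.Semiring.Sum +-*-semiring
  using (sum; sum-cong-≗; sum-replicate-zero; sum-remove; ∑-distrib-+; ∑-comm; ∑-permute; *-distribʳ-sum)
open import Data.Bool using (Bool; true; false; _∧_; not; _xor_)
open import Data.Bool.Properties
  using (∧-comm; ∧-conicalˡ; ∧-conicalʳ; xor-comm; not-involutive; ¬-not; not-¬)
open import Data.Fin using (Fin; toℕ; punchIn) renaming (zero to fzero; suc to fsuc)
import Data.Fin as Fin
open import Data.Fin.Properties using (punchInᵢ≢i)
open import Data.Product using (_×_; _,_; proj₁; proj₂)
open import Function.Bundles using (mk⤖)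
open import Function.Definitions using (Bijective)
open import Function.Properties.Bijection using (⤖⇒↔)
open import Relation.Binary.PropositionalEquality
  using (_≡_; _≢_; refl; sym; trans; cong; cong₂; module ≡-Reasoning)
open import Relation.Nullary using (does; yes)
open import Relation.Nullary.Decidable using (dec-true; dec-false)
open import Relation.Nullary.Negation using (contradiction)

open ≡-Reasoning

sumF≡sum : ∀ {n} (f : Fin n → ℕ) → sumF f ≡ sum f
sumF≡sum {zero}  f = refl
sumF≡sum {suc n} f = cong (f fzero +_) (sumF≡sum (λ i → f (fsuc i)))

sumF-cong : ∀ {n} {f g : Fin n → ℕ} → (∀ i → f i ≡ g i) → sumF f ≡ sumF g
sumF-cong {f = f} {g} f≗g = trans (sumF≡sum f) (trans (sum-cong-≗ f≗g) (sym (sumF≡sum g)))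

sumF-zero : ∀ n → sumF {n} (λ _ → 0) ≡ 0
sumF-zero n = trans (sumF≡sum {n} (λ _ → 0)) (sum-replicate-zero n)

sumF-+ : ∀ {n} (f g : Fin n → ℕ) → sumF (λ i → f i + g i) ≡ sumF f + sumF g
sumF-+ f g = trans (sumF≡sum (λ i → f i + g i))
  (trans (∑-distrib-+ f g) (sym (cong₂ _+_ (sumF≡sum f) (sumF≡sum g))))

sumF-*ʳ : ∀ {n} (f : Fin n → ℕ) k → sumF (λ i → f i * k) ≡ sumF f * k
sumF-*ʳ f k = trans (sumF≡sum (λ i → f i * k))
  (trans (sym (*-distribʳ-sum k f)) (cong (_* k) (sym (sumF≡sum f))))

sumF-swap : ∀ {m n} (f : Fin m → Fin n → ℕ) →
            sumF (λ i → sumF (λ j → f i j)) ≡ sumF (λ j → sumF (λ i → f i j))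
sumF-swap f = trans (nested f) (trans (∑-comm f) (sym (nested (λ j i → f i j))))
  where
  nested : ∀ {m n} (g : Fin m → Fin n → ℕ) → sumF (λ i → sumF (g i)) ≡ sum (λ i → sum (g i))
  nested g = trans (sumF≡sum (λ i → sumF (g i))) (sum-cong-≗ (λ i → sumF≡sum (g i)))

sumF-select : ∀ {n} (f : Fin n → ℕ) i → (∀ j → j ≢ i → f j ≡ 0) → sumF f ≡ f i
sumF-select {suc n} f i others = begin
  sumF f                                ≡⟨ sumF≡sum f ⟩
  sum f                                 ≡⟨ sum-remove {i = i} f ⟩
  f i + sum (λ j → f (punchIn i j))     ≡⟨ cong (f i +_) (sum-cong-≗ (λ j → others _ (punchInᵢ≢i i j))) ⟩
  f i + sum {n} (λ _ → 0)               ≡⟨ cong (f i +_) (sum-replicate-zero n) ⟩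
  f i + 0                               ≡⟨ +-identityʳ (f i) ⟩
  f i                                   ∎

sumF-∘-bijection : ∀ {n} {f : Fin n → Fin n} → Bijective _≡_ _≡_ f →
                   ∀ (g : Fin n → ℕ) → sumF (λ i → g (f i)) ≡ sumF g
sumF-∘-bijection {f = f} bij g =
  trans (sumF≡sum (λ i → g (f i))) (trans (sym (∑-permute g (⤖⇒↔ (mk⤖ bij)))) (sym (sumF≡sum g)))

bit≡0⇒false : ∀ {b} → bit b ≡ 0 → b ≡ false
bit≡0⇒false {false} _ = refl

countF-split : ∀ {n} {p q r : Fin n → Bool} → (∀ i → bit (p i) ≡ bit (q i) + bit (r i)) →
               countF p ≡ countF q + countF r
countF-split {q = q} {r} split = trans (sumF-cong split) (sumF-+ (λ i → bit (q i)) (λ i → bit (r i)))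

countCells-cong : ∀ {n} {P Q : Square n Bool} → (∀ r c → P r c ≡ Q r c) → countCells P ≡ countCells Q
countCells-cong P≗Q = sumF-cong (λ r → sumF-cong (λ c → cong bit (P≗Q r c)))

countCells-split : ∀ {n} {P Q R : Square n Bool} → (∀ r c → bit (P r c) ≡ bit (Q r c) + bit (R r c)) →
                   countCells P ≡ countCells Q + countCells R
countCells-split {Q = Q} {R} split =
  trans (sumF-cong (λ r → countF-split (split r))) (sumF-+ (λ r → countF (Q r)) (λ r → countF (R r)))

countCells-transpose : ∀ {n} (P : Square n Bool) → countCells P ≡ countCells (λ r c → P c r)
countCells-transpose P = sumF-swap (λ r c → bit (P r c))

countF-none : ∀ {n} {p : Fin n → Bool} → (∀ i → p i ≡ false) → countF p ≡ 0
countF-none {n} none = trans (sumF-cong (λ i → cong bit (none i))) (sumF-zero n)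

countF≡0⇒none : ∀ {n} (p : Fin n → Bool) → countF p ≡ 0 → ∀ i → p i ≡ false
countF≡0⇒none p #p fzero    = bit≡0⇒false (m+n≡0⇒m≡0 _ #p)
countF≡0⇒none p #p (fsuc i) = countF≡0⇒none (λ k → p (fsuc k)) (m+n≡0⇒n≡0 _ #p) i

countF-unique : ∀ {n} {p : Fin n → Bool} {i} → p i ≡ true → (∀ j → p j ≡ true → j ≡ i) → countF p ≡ 1
countF-unique {p = p} {i} pi only =
  trans (sumF-select _ i (λ j j≢i → cong bit (¬-not (λ pj → j≢i (only j pj))))) (cong bit pi)

countCells-unique : ∀ {n} {P : Square n Bool} {r₀ c₀} → P r₀ c₀ ≡ true →
                    (∀ r c → P r c ≡ true → (r , c) ≡ (r₀ , c₀)) → countCells P ≡ 1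
countCells-unique {r₀ = r₀} hit only =
  trans (sumF-select _ r₀ (λ r r≢r₀ → countF-none (λ c → ¬-not (λ e → r≢r₀ (cong proj₁ (only r c e))))))
        (countF-unique hit (λ c e → cong proj₂ (only r₀ c e)))

countF≡1⇒tail-false : ∀ {n} (p : Fin (suc n) → Bool) → countF p ≡ 1 → p fzero ≡ true →
                       ∀ i → p (fsuc i) ≡ false
countF≡1⇒tail-false p #p p0 = countF≡0⇒none (λ i → p (fsuc i))
  (suc-injective (trans (cong (λ b → bit b + countF (λ i → p (fsuc i))) (sym p0)) #p))

countF≡1⇒unique : ∀ {n} (p : Fin n → Bool) → countF p ≡ 1 →
                  ∀ {i j} → p i ≡ true → p j ≡ true → i ≡ j
countF≡1⇒unique {suc n} p #p {fzero}  {fzero}  _  _  = refl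
countF≡1⇒unique {suc n} p #p {fzero}  {fsuc j} p0 pj = contradiction (countF≡1⇒tail-false p #p p0 j) (not-¬ pj)
countF≡1⇒unique {suc n} p #p {fsuc i} {fzero}  pi p0 = contradiction (countF≡1⇒tail-false p #p p0 i) (not-¬ pi)
countF≡1⇒unique {suc n} p #p {fsuc i} {fsuc j} pi pj =
  cong fsuc (countF≡1⇒unique tail (trans (cong (λ b → bit b + countF tail) (sym p0≡false)) #p) pi pj)
  where
  tail : Fin n → Bool
  tail k = p (fsuc k)
  p0≡false : p fzero ≡ false
  p0≡false = ¬-not (λ p0 → not-¬ pi (countF≡1⇒tail-false p #p p0 i))

countF-guard : ∀ {n} b (p : Fin n → Bool) → (b ≡ true → countF p ≡ 1) → countF (λ i → b ∧ p i) ≡ bit b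
countF-guard true  p #p = #p refl
countF-guard {n} false p _ = sumF-zero n

countF-∘-bijection : ∀ {n} {f : Fin n → Fin n} → Bijective _≡_ _≡_ f →
                     ∀ (p : Fin n → Bool) → countF (λ i → p (f i)) ≡ countF p
countF-∘-bijection bij p = sumF-∘-bijection bij (λ i → bit (p i))

-- Symbol classes of Latin squares

symEq-refl : ∀ {n} (s : Fin n) → symEq s s ≡ true
symEq-refl s = dec-true (s Fin.≟ s) refl

symEq⇒≡ : ∀ {n} {s t : Fin n} → symEq s t ≡ true → s ≡ t
symEq⇒≡ {s = s} {t} e with s Fin.≟ t
... | yes s≡t = s≡t

countF-symEq : ∀ {n} (t : Fin n) → countF (λ s → symEq s t) ≡ 1
countF-symEq t = countF-unique {p = λ s → symEq s t} (symEq-refl t) (λ s e → symEq⇒≡ e)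

bijective⇒countF-fibre : ∀ {n} {f : Fin n → Fin n} → Bijective _≡_ _≡_ f →
                         ∀ t → countF (λ i → symEq (f i) t) ≡ 1
bijective⇒countF-fibre bij t = trans (countF-∘-bijection bij (λ s → symEq s t)) (countF-symEq t)

orthogonal⇒countCells-pair : ∀ {n} {L M : Square n (Fin n)} → Orthogonal L M →
  ∀ s t → countCells (λ r c → symEq (L r c) s ∧ symEq (M r c) t) ≡ 1
orthogonal⇒countCells-pair {L = L} {M} (inj , surj) s t with surj (s , t)
... | (r₀ , c₀) , hits = countCells-unique on-cell only-cell
  where
  hit : (L r₀ c₀ , M r₀ c₀) ≡ (s , t)
  hit = hits refl
  on-cell : symEq (L r₀ c₀) s ∧ symEq (M r₀ c₀) t ≡ true
  on-cell = cong₂ _∧_ (dec-true (L r₀ c₀ Fin.≟ s) (cong proj₁ hit))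
                      (dec-true (M r₀ c₀ Fin.≟ t) (cong proj₂ hit))
  only-cell : ∀ r c → symEq (L r c) s ∧ symEq (M r c) t ≡ true → (r , c) ≡ (r₀ , c₀)
  only-cell r c e =
    inj (trans (cong₂ _,_ (symEq⇒≡ (∧-conicalˡ _ _ e)) (symEq⇒≡ (∧-conicalʳ _ _ e))) (sym hit))

sift : ∀ {n} w (s : Fin n) (θ : Fin n → Bool) →
       sumF (λ t → bit (w ∧ symEq s t) * bit (θ t)) ≡ bit (w ∧ θ s)
sift {n} false s θ = sumF-zero n
sift     true  s θ = begin
  sumF (λ t → bit (symEq s t) * bit (θ t))  ≡⟨ sumF-select _ s off-s ⟩
  bit (symEq s s) * bit (θ s)               ≡⟨ cong (λ b → bit b * bit (θ s)) (symEq-refl s) ⟩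
  1 * bit (θ s)                             ≡⟨ *-identityˡ (bit (θ s)) ⟩
  bit (θ s)                                 ∎
  where
  off-s : ∀ t → t ≢ s → bit (symEq s t) * bit (θ t) ≡ 0
  off-s t t≢s = cong (λ b → bit b * bit (θ t)) (dec-false (s Fin.≟ t) (λ s≡t → t≢s (sym s≡t)))

countCells-fibres : ∀ {n} (ℓ : Square n Bool) (M : Square n (Fin n)) (θ : Fin n → Bool) →
  countCells (λ r c → ℓ r c ∧ θ (M r c)) ≡
  sumF (λ t → countCells (λ r c → ℓ r c ∧ symEq (M r c) t) * bit (θ t))
countCells-fibres {n} ℓ M θ = begin
  countCells (λ r c → ℓ r c ∧ θ (M r c))
    ≡⟨ sumF-cong (λ r → sumF-cong (λ c → sym (sift (ℓ r c) (M r c) θ))) ⟩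
  sumF (λ r → sumF (λ c → sumF (λ t → term r c t)))   ≡⟨ sumF-cong (λ r → sumF-swap (term r)) ⟩
  sumF (λ r → sumF (λ t → sumF (λ c → term r c t)))   ≡⟨ sumF-swap (λ r t → sumF (λ c → term r c t)) ⟩
  sumF (λ t → sumF (λ r → sumF (λ c → term r c t)))   ≡⟨ sumF-cong pull-out ⟩
  sumF (λ t → countCells (fibre t) * bit (θ t))       ∎
  where
  fibre : Fin n → Square n Bool
  fibre t r c = ℓ r c ∧ symEq (M r c) t
  term : Fin n → Fin n → Fin n → ℕ
  term r c t = bit (fibre t r c) * bit (θ t)
  pull-out : ∀ t → sumF (λ r → sumF (λ c → term r c t)) ≡ countCells (fibre t) * bit (θ t)
  pull-out t = trans (sumF-cong (λ r → sumF-*ʳ (λ c → bit (fibre t r c)) (bit (θ t))))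
                     (sumF-*ʳ (λ r → countF (fibre t r)) (bit (θ t)))

countCells-transversal : ∀ {n} {ℓ : Square n Bool} {M : Square n (Fin n)} →
  (∀ t → countCells (λ r c → ℓ r c ∧ symEq (M r c) t) ≡ 1) →
  ∀ θ → countCells (λ r c → ℓ r c ∧ θ (M r c)) ≡ countF θ
countCells-transversal {ℓ = ℓ} {M} once θ =
  trans (countCells-fibres ℓ M θ) (sumF-cong (λ t → trans (cong (_* bit (θ t)) (once t)) (*-identityˡ _)))

-- Cells of a template of type (4,4,4,4)

even-weight⇒xor : ∀ x y a b → (bit x + bit y + bit a + bit b) % 2 ≡ 0 → a xor b ≡ x xor y
even-weight⇒xor false false false false _ = refl
even-weight⇒xor false false false true  ()
even-weight⇒xor false false true  false ()
even-weight⇒xor false false true  true  _ = refl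
even-weight⇒xor false true  false false ()
even-weight⇒xor false true  false true  _ = refl
even-weight⇒xor false true  true  false _ = refl
even-weight⇒xor false true  true  true  ()
even-weight⇒xor true  false false false ()
even-weight⇒xor true  false false true  _ = refl
even-weight⇒xor true  false true  false _ = refl
even-weight⇒xor true  false true  true  ()
even-weight⇒xor true  true  false false _ = refl
even-weight⇒xor true  true  false true  ()
even-weight⇒xor true  true  true  false ()
even-weight⇒xor true  true  true  true  _ = refl

weight≡4 : ∀ x y a b → does ((bit x + bit y + bit a + bit b) ℕ.≟ 4) ≡ x ∧ y ∧ lastBits a b true true
weight≡4 false false false false = refl
weight≡4 false false false true  = refl
weight≡4 false false true  false = refl
weight≡4 false false true  true  = refl
weight≡4 false true  false false = refl
weight≡4 false true  false true  = refl
weight≡4 false true  true  false = refl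
weight≡4 false true  true  true  = refl
weight≡4 true  false false false = refl
weight≡4 true  false false true  = refl
weight≡4 true  false true  false = refl
weight≡4 true  false true  true  = refl
weight≡4 true  true  false false = refl
weight≡4 true  true  false true  = refl
weight≡4 true  true  true  false = refl
weight≡4 true  true  true  true  = refl

high≡not-low : ∀ i → high i ≡ not (low i)
high≡not-low i = 4≤ᵇ≡not-<ᵇ4 (toℕ i)
  where
  4≤ᵇ≡not-<ᵇ4 : ∀ k → (4 ℕ.≤ᵇ k) ≡ not (k ℕ.<ᵇ 4)
  4≤ᵇ≡not-<ᵇ4 0 = refl
  4≤ᵇ≡not-<ᵇ4 1 = refl
  4≤ᵇ≡not-<ᵇ4 2 = refl
  4≤ᵇ≡not-<ᵇ4 3 = refl
  4≤ᵇ≡not-<ᵇ4 (suc (suc (suc (suc _)))) = refl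

low≡not-high : ∀ i → low i ≡ not (high i)
low≡not-high i = trans (sym (not-involutive (low i))) (cong not (sym (high≡not-low i)))

high⇒not-low : ∀ i → high i ≡ true → low i ≡ false
high⇒not-low i hi = trans (low≡not-high i) (cong not hi)

-- Lines of a template

typeCount : ∀ {n} (g a b : Fin n → Bool) → Bool → Bool → ℕ
typeCount g a b x y = countF (λ j → g j ∧ lastBits (a j) (b j) x y)

TypeSplit : (u ū a b : Bool) → Set
TypeSplit u ū a b =
  (bit a ≡ bit (u ∧ lastBits a b true true) + bit (ū ∧ lastBits a b true false)) ×
  (bit b ≡ bit (u ∧ lastBits a b true true) + bit (ū ∧ lastBits a b false true)) ×
  (bit ū ≡ bit (ū ∧ lastBits a b true false) + bit (ū ∧ lastBits a b false true)) ×
  (bit u ≡ bit (u ∧ lastBits a b true true) + bit (u ∧ lastBits a b false false))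

typeSplit : ∀ u ū a b → ū ≡ not u → a xor b ≡ ū → TypeSplit u ū a b
typeSplit false _ false false refl ()
typeSplit false _ false true  refl refl = refl , refl , refl , refl
typeSplit false _ true  false refl refl = refl , refl , refl , refl
typeSplit false _ true  true  refl ()
typeSplit true  _ false false refl refl = refl , refl , refl , refl
typeSplit true  _ false true  refl ()
typeSplit true  _ true  false refl ()
typeSplit true  _ true  true  refl refl = refl , refl , refl , refl

typeCount-relations : ∀ {n} (s s̄ a b : Fin n → Bool) →
  (∀ j → s̄ j ≡ not (s j)) → (∀ j → a j xor b j ≡ s̄ j) →
  (countF a ≡ typeCount s a b true true + typeCount s̄ a b true false) ×
  (countF b ≡ typeCount s a b true true + typeCount s̄ a b false true) ×
  (countF s̄ ≡ typeCount s̄ a b true false + typeCount s̄ a b false true) ×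
  (countF s ≡ typeCount s a b true true + typeCount s a b false false)
typeCount-relations s s̄ a b s̄≡not-s xor≡s̄ =
  countF-split (λ j → proj₁ (split j)) ,
  countF-split (λ j → proj₁ (proj₂ (split j))) ,
  countF-split (λ j → proj₁ (proj₂ (proj₂ (split j)))) ,
  countF-split (λ j → proj₂ (proj₂ (proj₂ (split j))))
  where
  split : ∀ j → TypeSplit (s j) (s̄ j) (a j) (b j)
  split j = typeSplit (s j) (s̄ j) (a j) (b j) (s̄≡not-s j) (xor≡s̄ j)

RelationalLineTypes : (a b : Fin 10 → Bool) → Set
RelationalLineTypes a b =
  (typeCount low a b true true ≡ 1) × (typeCount high a b true false ≡ 3) × (typeCount high a b false true ≡ 3)

NonRelationalLineTypes : (a b : Fin 10 → Bool) → Set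
NonRelationalLineTypes a b =
  ((typeCount low a b false true ≡ 2) × (typeCount low a b true false ≡ 2)) ×
  ((typeCount high a b true true ≡ 2) × (typeCount high a b false false ≡ 4))

relationalLine-equations : ∀ {x p q} → x + p ≡ 4 → x + q ≡ 4 → p + q ≡ 6 → x ≡ 1 × p ≡ 3 × q ≡ 3
relationalLine-equations {0} refl refl ()
relationalLine-equations {1} refl refl refl = refl , refl , refl
relationalLine-equations {2} refl refl ()
relationalLine-equations {3} refl refl ()
relationalLine-equations {4} refl refl ()
relationalLine-equations {suc (suc (suc (suc (suc _))))} ()

nonRelationalLine-equations : ∀ {y p q z} → y + p ≡ 4 → y + q ≡ 4 → p + q ≡ 4 → y + z ≡ 6 →
                              (q ≡ 2 × p ≡ 2) × (y ≡ 2 × z ≡ 4)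
nonRelationalLine-equations {0} refl refl () _
nonRelationalLine-equations {1} refl refl () _
nonRelationalLine-equations {2} refl refl refl refl = (refl , refl) , (refl , refl)
nonRelationalLine-equations {3} refl refl () _
nonRelationalLine-equations {4} refl refl () _
nonRelationalLine-equations {suc (suc (suc (suc (suc _))))} ()

relationalLine : ∀ i (a b : Fin 10 → Bool) → low i ≡ true → (∀ j → a j xor b j ≡ low i xor low j) →
                 countF a ≡ 4 → countF b ≡ 4 → RelationalLineTypes a b
relationalLine i a b li xor≡ #a #b =
  let #a≡ , #b≡ , #high≡ , _ = typeCount-relations low high a b high≡not-low xor≡high
  in  relationalLine-equations (trans (sym #a≡) #a) (trans (sym #b≡) #b) (sym #high≡)
  where
  xor≡high : ∀ j → a j xor b j ≡ high j
  xor≡high j = trans (xor≡ j) (trans (cong (_xor low j) li) (sym (high≡not-low j)))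

nonRelationalLine : ∀ i (a b : Fin 10 → Bool) → high i ≡ true → (∀ j → a j xor b j ≡ low i xor low j) →
                    countF a ≡ 4 → countF b ≡ 4 → NonRelationalLineTypes a b
nonRelationalLine i a b hi xor≡ #a #b =
  let #a≡ , #b≡ , #low≡ , #high≡ = typeCount-relations high low a b low≡not-high xor≡low
  in  nonRelationalLine-equations (trans (sym #a≡) #a) (trans (sym #b≡) #b) (sym #low≡) (sym #high≡)
  where
  xor≡low : ∀ j → a j xor b j ≡ low j
  xor≡low j = trans (xor≡ j) (cong (_xor low j) (high⇒not-low i hi))

module Template {F0 F1 : Square 10 Bool} (freq0 : IsFreqSquare 4 F0) (freq1 : IsFreqSquare 4 F1)
                (even : ∀ r c → weight 4 4 F0 F1 r c % 2 ≡ 0) where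

  xor-rows : ∀ r c → F0 r c xor F1 r c ≡ low r xor low c
  xor-rows r c = even-weight⇒xor (low r) (low c) (F0 r c) (F1 r c) (even r c)

  xor-columns : ∀ c r → F0 r c xor F1 r c ≡ low c xor low r
  xor-columns c r = trans (xor-rows r c) (xor-comm (low r) (low c))

  relationalRow : ∀ r → low r ≡ true → RelationalLineTypes (F0 r) (F1 r)
  relationalRow r lr = relationalLine r (F0 r) (F1 r) lr (xor-rows r) (proj₁ freq0 r) (proj₁ freq1 r)

  relationalColumn : ∀ c → low c ≡ true → RelationalLineTypes (λ r → F0 r c) (λ r → F1 r c)
  relationalColumn c lc =
    relationalLine c (λ r → F0 r c) (λ r → F1 r c) lc (xor-columns c) (proj₂ freq0 c) (proj₂ freq1 c)

  nonRelationalRow : ∀ r → high r ≡ true → NonRelationalLineTypes (F0 r) (F1 r)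
  nonRelationalRow r hr = nonRelationalLine r (F0 r) (F1 r) hr (xor-rows r) (proj₁ freq0 r) (proj₁ freq1 r)

  nonRelationalColumn : ∀ c → high c ≡ true → NonRelationalLineTypes (λ r → F0 r c) (λ r → F1 r c)
  nonRelationalColumn c hc =
    nonRelationalLine c (λ r → F0 r c) (λ r → F1 r c) hc (xor-columns c) (proj₂ freq0 c) (proj₂ freq1 c)

  weight4≡ : ∀ r c → weightIs4 F0 F1 r c ≡ low r ∧ low c ∧ lastBits (F0 r c) (F1 r c) true true
  weight4≡ r c = weight≡4 (low r) (low c) (F0 r c) (F1 r c)

  weight4-count : countCells (weightIs4 F0 F1) ≡ 4
  weight4-count = sumF-cong (λ r →
    trans (sumF-cong (λ c → cong bit (weight4≡ r c)))
          (countF-guard (low r) (λ c → low c ∧ lastBits (F0 r c) (F1 r c) true true)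
                        (λ lr → proj₁ (relationalRow r lr))))

  weight4-distinct : ∀ r c r' c' → weightIs4 F0 F1 r c ≡ true → weightIs4 F0 F1 r' c' ≡ true →
                     (r , c) ≢ (r' , c') → (r ≢ r' × c ≢ c')
  weight4-distinct r c r' c' w w' rc≢r'c' = r≢r' , c≢c'
    where
    unpack : ∀ r c → weightIs4 F0 F1 r c ≡ true →
             (low r ≡ true) × (low c ≡ true) × (lastBits (F0 r c) (F1 r c) true true ≡ true)
    unpack r c w =
      let t = lastBits (F0 r c) (F1 r c) true true
          w∧ = trans (sym (weight4≡ r c)) w
          lc∧t = ∧-conicalʳ (low r) (low c ∧ t) w∧
      in  ∧-conicalˡ (low r) (low c ∧ t) w∧ , ∧-conicalˡ (low c) t lc∧t , ∧-conicalʳ (low c) t lc∧t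
    r≢r' : r ≢ r'
    r≢r' refl =
      let lr , lc , t = unpack r c w ; _ , lc' , t' = unpack r c' w'
      in  rc≢r'c' (cong (r ,_) (countF≡1⇒unique (λ j → low j ∧ lastBits (F0 r j) (F1 r j) true true)
                                  (proj₁ (relationalRow r lr)) (cong₂ _∧_ lc t) (cong₂ _∧_ lc' t')))
    c≢c' : c ≢ c'
    c≢c' refl =
      let lr , lc , t = unpack r c w ; lr' , _ , t' = unpack r' c w'
      in  rc≢r'c' (cong (_, c) (countF≡1⇒unique (λ i → low i ∧ lastBits (F0 i c) (F1 i c) true true)
                                  (proj₁ (relationalColumn c lc)) (cong₂ _∧_ lr t) (cong₂ _∧_ lr' t')))

-- Relational lines of the net

record Transversal {n} (ℓ : Square n Bool) : Set where
  field
    rows    : ∀ r → countF (ℓ r) ≡ 1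
    columns : ∀ c → countF (λ r → ℓ r c) ≡ 1

transpose-transversal : ∀ {n} {ℓ : Square n Bool} → Transversal ℓ → Transversal (λ c r → ℓ r c)
transpose-transversal tr = record { rows = Transversal.columns tr ; columns = Transversal.rows tr }

latin⇒transversal : ∀ {n} {L : Square n (Fin n)} → IsLatin L → ∀ s → Transversal (λ r c → symEq (L r c) s)
latin⇒transversal (rows , columns) s = record
  { rows    = λ r → bijective⇒countF-fibre (rows r) s
  ; columns = λ c → bijective⇒countF-fibre (columns c) s
  }

countCells-guardRows : ∀ {n} {ℓ : Square n Bool} → Transversal ℓ →
                       ∀ g → countCells (λ r c → g r ∧ ℓ r c) ≡ countF g
countCells-guardRows {ℓ = ℓ} tr g = sumF-cong (λ r → countF-guard (g r) (ℓ r) (λ _ → Transversal.rows tr r))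

countCells-guardColumns : ∀ {n} {ℓ : Square n Bool} → Transversal ℓ →
                          ∀ g → countCells (λ r c → g c ∧ ℓ r c) ≡ countF g
countCells-guardColumns {ℓ = ℓ} tr g =
  trans (countCells-transpose (λ r c → g c ∧ ℓ r c)) (countCells-guardRows (transpose-transversal tr) g)

relationalSymbols-count : ∀ {n} {L : Square n (Fin n)} (θ : Fin n → Bool) {F : Square n Bool} →
  IsLatin L → (∀ r c → θ (L r c) ≡ F r c) → ∀ r → countF θ ≡ countF (F r)
relationalSymbols-count θ (rows , _) refines r =
  trans (sym (countF-∘-bijection (rows r) θ)) (sumF-cong (λ c → cong bit (refines r c)))

∧-cong-when : ∀ w {x y} → (w ≡ true → x ≡ y) → w ∧ x ≡ w ∧ y
∧-cong-when true  x≡y = x≡y refl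
∧-cong-when false _   = refl

relationalLine-diagonal :
  ∀ {n} (ρ : Fin n → Bool) (M M' : Square n (Fin n)) (θ θ' : Fin n → Bool) {F F' : Square n Bool} →
  (∀ r c → θ (M r c) ≡ F r c) → (∀ r c → θ' (M' r c) ≡ F' r c) →
  (∀ r c → F r c xor F' r c ≡ ρ r xor ρ c) →
  (∀ s t → countCells (λ r c → symEq (M r c) s ∧ symEq (M' r c) t) ≡ 1) →
  ∀ s → θ s ≡ true → countCells (λ r c → symEq (M r c) s ∧ not (ρ r xor ρ c)) ≡ countF θ'
relationalLine-diagonal ρ M M' θ θ' {F} {F'} refines refines' xor≡ pairs s θs =
  trans (countCells-cong (λ r c → ∧-cong-when (symEq (M r c) s) (F'-on-line r c)))
        (countCells-transversal (pairs s) θ')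
  where
  F'-on-line : ∀ r c → symEq (M r c) s ≡ true → not (ρ r xor ρ c) ≡ θ' (M' r c)
  F'-on-line r c on = begin
    not (ρ r xor ρ c)           ≡⟨ cong not (sym (xor≡ r c)) ⟩
    not (F r c xor F' r c)      ≡⟨ cong (λ f → not (f xor F' r c)) F≡true ⟩
    not (not (F' r c))          ≡⟨ not-involutive (F' r c) ⟩
    F' r c                      ≡⟨ sym (refines' r c) ⟩
    θ' (M' r c)                 ∎
    where
    F≡true : F r c ≡ true
    F≡true = trans (sym (refines r c)) (trans (cong θ (symEq⇒≡ on)) θs)

split-bit : ∀ u ū w → ū ≡ not u → bit w ≡ bit (u ∧ w) + bit (ū ∧ w)
split-bit false _ w     refl = refl
split-bit true  _ false refl = refl
split-bit true  _ true  refl = refl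

split-bit-under : ∀ g u ū w → ū ≡ not u → bit (g ∧ w) ≡ bit (g ∧ u ∧ w) + bit (g ∧ ū ∧ w)
split-bit-under false u ū w _    = refl
split-bit-under true  u ū w ū≡¬u = split-bit u ū w ū≡¬u

diagonal-bits : ∀ u ū v v̄ w → ū ≡ not u → v̄ ≡ not v →
                bit (w ∧ not (u xor v)) ≡ bit (u ∧ v ∧ w) + bit (ū ∧ v̄ ∧ w)
diagonal-bits false _ false _ false refl refl = refl
diagonal-bits false _ false _ true  refl refl = refl
diagonal-bits false _ true  _ false refl refl = refl
diagonal-bits false _ true  _ true  refl refl = refl
diagonal-bits true  _ false _ false refl refl = refl
diagonal-bits true  _ false _ true  refl refl = refl
diagonal-bits true  _ true  _ false refl refl = refl
diagonal-bits true  _ true  _ true  refl refl = refl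

quadrant-equations : ∀ {a b c d} → a + b ≡ 4 → a + c ≡ 4 → a + d ≡ 4 → b + d ≡ 6 →
                     a ≡ 1 × b ≡ 3 × c ≡ 3 × d ≡ 3
quadrant-equations {0} refl refl refl ()
quadrant-equations {1} refl refl refl refl = refl , refl , refl , refl
quadrant-equations {2} refl refl refl ()
quadrant-equations {3} refl refl refl ()
quadrant-equations {4} refl refl refl ()
quadrant-equations {suc (suc (suc (suc (suc _))))} ()

transversal-quadrants : ∀ {ℓ : Square 10 Bool} → Transversal ℓ →
  countCells (λ r c → ℓ r c ∧ not (low r xor low c)) ≡ 4 → QuadCounts ℓ
transversal-quadrants {ℓ} tr diagonal = quadrant-equations Q₁+Q₂ Q₁+Q₃ Q₁+Q₄ Q₂+Q₄
  where
  ℓ∩ : (Fin 10 → Bool) → (Fin 10 → Bool) → Square 10 Bool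
  ℓ∩ g h r c = g r ∧ h c ∧ ℓ r c
  split : ∀ {P} g h g' h' → (∀ r c → bit (P r c) ≡ bit (ℓ∩ g h r c) + bit (ℓ∩ g' h' r c)) →
          countCells P ≡ countCells (ℓ∩ g h) + countCells (ℓ∩ g' h')
  split g h g' h' = countCells-split {Q = ℓ∩ g h} {R = ℓ∩ g' h'}
  Q₁+Q₂ : countCells (ℓ∩ low low) + countCells (ℓ∩ low high) ≡ 4
  Q₁+Q₂ = trans (sym (split low low low high (λ r c →
                  split-bit-under (low r) (low c) (high c) (ℓ r c) (high≡not-low c))))
                (countCells-guardRows tr low)
  Q₁+Q₃ : countCells (ℓ∩ low low) + countCells (ℓ∩ high low) ≡ 4
  Q₁+Q₃ = trans (sym (split low low high low (λ r c →
                  split-bit (low r) (high r) (low c ∧ ℓ r c) (high≡not-low r))))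
                (countCells-guardColumns tr low)
  Q₂+Q₄ : countCells (ℓ∩ low high) + countCells (ℓ∩ high high) ≡ 6
  Q₂+Q₄ = trans (sym (split low high high high (λ r c →
                  split-bit (low r) (high r) (high c ∧ ℓ r c) (high≡not-low r))))
                (countCells-guardColumns tr high)
  Q₁+Q₄ : countCells (ℓ∩ low low) + countCells (ℓ∩ high high) ≡ 4
  Q₁+Q₄ = trans (sym (split low low high high (λ r c →
                  diagonal-bits (low r) (high r) (low c) (high c) (ℓ r c) (high≡not-low r) (high≡not-low c))))
                diagonal

relationalLine-quadrants :
  ∀ (M M' : Square 10 (Fin 10)) (θ θ' : Fin 10 → Bool) {F F' : Square 10 Bool} →
  IsLatin M → (∀ r c → θ (M r c) ≡ F r c) → (∀ r c → θ' (M' r c) ≡ F' r c) →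
  (∀ r c → F r c xor F' r c ≡ low r xor low c) →
  (∀ s t → countCells (λ r c → symEq (M r c) s ∧ symEq (M' r c) t) ≡ 1) → countF θ' ≡ 4 →
  ∀ s → θ s ≡ true → QuadCounts (λ r c → symEq (M r c) s)
relationalLine-quadrants M M' θ θ' latin refines refines' xor≡ pairs #θ' s θs =
  transversal-quadrants (latin⇒transversal latin s)
    (trans (relationalLine-diagonal low M M' θ θ' refines refines' xor≡ pairs s θs) #θ')

lemma3p2 : (F0 F1 : Square 10 Bool) (L0 L1 : Square 10 (Fin 10)) (θ0 θ1 : Fin 10 → Bool) →
  IsTemplate4 10 4 4 4 4 F0 F1 → Is4Net L0 L1 → Refines L0 L1 F0 F1 θ0 θ1 →
  -- (i)
  ((countCells (λ r c → weightIs4 F0 F1 r c) ≡ 4) ×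
   (∀ r c r' c' → weightIs4 F0 F1 r c ≡ true → weightIs4 F0 F1 r' c' ≡ true →
      (r , c) ≢ (r' , c') → (r ≢ r' × c ≢ c'))) ×
  -- (ii)
  ((∀ r → low r ≡ true →
      (countF (λ c → high c ∧ lastBits (F0 r c) (F1 r c) true false) ≡ 3) ×
      (countF (λ c → high c ∧ lastBits (F0 r c) (F1 r c) false true) ≡ 3)) ×
   (∀ c → low c ≡ true →
      (countF (λ r → high r ∧ lastBits (F0 r c) (F1 r c) true false) ≡ 3) ×
      (countF (λ r → high r ∧ lastBits (F0 r c) (F1 r c) false true) ≡ 3))) ×
  -- (iii)
  ((∀ s → θ0 s ≡ true → QuadCounts (λ r c → symEq (L0 r c) s)) ×
   (∀ s → θ1 s ≡ true → QuadCounts (λ r c → symEq (L1 r c) s))) ×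
  -- (iv)
  ((∀ c → high c ≡ true →
      (countF (λ r → low r ∧ lastBits (F0 r c) (F1 r c) false true) ≡ 2) ×
      (countF (λ r → low r ∧ lastBits (F0 r c) (F1 r c) true false) ≡ 2)) ×
   (∀ r → high r ≡ true →
      (countF (λ c → low c ∧ lastBits (F0 r c) (F1 r c) false true) ≡ 2) ×
      (countF (λ c → low c ∧ lastBits (F0 r c) (F1 r c) true false) ≡ 2)) ×
   (∀ r → high r ≡ true →
      (countF (λ c → high c ∧ lastBits (F0 r c) (F1 r c) true true) ≡ 2) ×
      (countF (λ c → high c ∧ lastBits (F0 r c) (F1 r c) false false) ≡ 4)) ×
   (∀ c → high c ≡ true →
      (countF (λ r → high r ∧ lastBits (F0 r c) (F1 r c) true true) ≡ 2) ×
      (countF (λ r → high r ∧ lastBits (F0 r c) (F1 r c) false false) ≡ 4)))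
lemma3p2 F0 F1 L0 L1 θ0 θ1 (_ , _ , _ , _ , _ , freq0 , freq1 , _ , even)
         (latin0 , latin1 , orthogonal) (refines0 , refines1) =
  (weight4-count , weight4-distinct) ,
  ((λ r lr → proj₂ (relationalRow r lr)) , (λ c lc → proj₂ (relationalColumn c lc))) ,
  (relationalLine-quadrants L0 L1 θ0 θ1 latin0 refines0 refines1 xor-rows pairs01 #θ1 ,
   relationalLine-quadrants L1 L0 θ1 θ0 latin1 refines1 refines0 xor-rows₁₀ pairs10 #θ0) ,
  (λ c hc → proj₁ (nonRelationalColumn c hc)) ,
  (λ r hr → proj₁ (nonRelationalRow r hr)) ,
  (λ r hr → proj₂ (nonRelationalRow r hr)) ,
  (λ c hc → proj₂ (nonRelationalColumn c hc))
  where
  open Template freq0 freq1 even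
  pairs01 : ∀ s t → countCells (λ r c → symEq (L0 r c) s ∧ symEq (L1 r c) t) ≡ 1
  pairs01 = orthogonal⇒countCells-pair orthogonal
  pairs10 : ∀ t s → countCells (λ r c → symEq (L1 r c) t ∧ symEq (L0 r c) s) ≡ 1
  pairs10 t s = trans (countCells-cong (λ r c → ∧-comm (symEq (L1 r c) t) (symEq (L0 r c) s))) (pairs01 s t)
  xor-rows₁₀ : ∀ r c → F1 r c xor F0 r c ≡ low r xor low c
  xor-rows₁₀ r c = trans (xor-comm (F1 r c) (F0 r c)) (xor-rows r c)
  #θ0 : countF θ0 ≡ 4
  #θ0 = trans (relationalSymbols-count θ0 latin0 refines0 fzero) (proj₁ freq0 fzero)
  #θ1 : countF θ1 ≡ 4
  #θ1 = trans (relationalSymbols-count θ1 latin1 refines1 fzero) (proj₁ freq1 fzero)
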